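{- Let $\Lambda$ be a partially ordered set. Every (MacNeille) closed upper set $Z\subseteq\Lambda^{*}$ obeys the following four rules (for all words $y,z\in\Lambda^*$): (cancellation) if $y\alpha z\in Z$ and $y\beta z\in Z$ where $\alpha,\beta\in\Lambda$ are incompatible, then $yz\in Z$; (reduction) if $y\alpha\alpha z\in Z$ and $y\gamma z\in Z$ where $\alpha<\gamma$ in $\Lambda$, then $y\alpha z\in Z$; (permutation) if $y\alpha\beta z\in Z$ and $y\gamma z\in Z$ where $\alpha,\beta,\gamma\in\Lambda$, $\alpha,\beta$ are incomparable and both below $\gamma$, then $y\beta\alpha z\in Z$; (meet) if $y\alpha z\in Z$ and $y\beta z\in Z$ where $\alpha,\beta\in\Lambda$ are incomparable and have a meet $\alpha\wedge\beta$ in $\Lambda$, then $y(\alpha\wedge\beta)z\in Z$.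
   Context: $\Lambda^{*}$ is the set of finite words over $\Lambda$ including the empty word, with concatenation, ordered by: $\alpha_1\cdots\alpha_m\le\beta_1\cdots\beta_n$ iff there are $1\le i_1<\dots<i_m\le n$ with $\alpha_j\le\beta_{i_j}$ for all $j$. An upper set is a subset $Z$ with $z\in Z, z\le y\Rightarrow y\in Z$. For $X\subseteq\Lambda^*$, $X^{\Delta}=\{y: x\le y\ \forall x\in X\}$, $X^{\nabla}=\{w: w\le x\ \forall x\in X\}$ (with $\emptyset^\Delta=\emptyset^\nabla=\Lambda^*$); an upper set $Z$ is closed if $Z=(Z^{\nabla})^{\Delta}$. Two letters are compatible if they have a common lower bound in $\Lambda$, incompatible otherwise. -}

module Defs where

open import Level using (Level; _⊔_; suc)
open import Data.List using (List; []; _∷_; _++_)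
open import Data.Product using (_×_; ∃-syntax; Σ)
open import Relation.Nullary using (¬_)
open import Relation.Binary.Bundles using (Poset)

module Words {c ℓ₁ ℓ₂ : Level} (Λ : Poset c ℓ₁ ℓ₂) where
  open Poset Λ public using (_≤_; _≈_) renaming (Carrier to L)

  _<_ : L → L → Set (ℓ₁ ⊔ ℓ₂)
  α < γ = α ≤ γ × ¬ (α ≈ γ)

  Word : Set c
  Word = List L

  -- subword (embedding) order on Λ*:
  -- α₁⋯αₘ ≼ β₁⋯βₙ iff there are i₁ < ⋯ < iₘ with αⱼ ≤ β_{iⱼ}
  data _≼_ : Word → Word → Set (c ⊔ ℓ₂) where
    []≼   : ∀ {ys} → [] ≼ ys
    take  : ∀ {x y xs ys} → x ≤ y → xs ≼ ys → (x ∷ xs) ≼ (y ∷ ys)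
    skip  : ∀ {xs y ys} → xs ≼ ys → xs ≼ (y ∷ ys)

  Subset : (ℓ : Level) → Set (c ⊔ suc ℓ)
  Subset ℓ = Word → Set ℓ

  IsUpperSet : ∀ {ℓ} → Subset ℓ → Set (c ⊔ ℓ₂ ⊔ ℓ)
  IsUpperSet Z = ∀ {z y} → Z z → z ≼ y → Z y

  _^Δ : ∀ {ℓ} → Subset ℓ → Subset (c ⊔ ℓ₂ ⊔ ℓ)
  (X ^Δ) y = ∀ x → X x → x ≼ y

  _^∇ : ∀ {ℓ} → Subset ℓ → Subset (c ⊔ ℓ₂ ⊔ ℓ)
  (X ^∇) w = ∀ x → X x → w ≼ x

  IsClosed : ∀ {ℓ} → Subset ℓ → Set (c ⊔ ℓ₂ ⊔ ℓ)
  IsClosed Z = IsUpperSet Z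
             × (∀ y → Z y → ((Z ^∇) ^Δ) y)
             × (∀ y → ((Z ^∇) ^Δ) y → Z y)

  Compatible : L → L → Set (c ⊔ ℓ₂)
  Compatible α β = ∃[ δ ] (δ ≤ α × δ ≤ β)

  Incompatible : L → L → Set (c ⊔ ℓ₂)
  Incompatible α β = ¬ Compatible α β

  Incomparable : L → L → Set ℓ₂
  Incomparable α β = ¬ (α ≤ β) × ¬ (β ≤ α)

  IsMeet : L → L → L → Set (c ⊔ ℓ₂)
  IsMeet α β μ = μ ≤ α × μ ≤ β × (∀ δ → δ ≤ α → δ ≤ β → δ ≤ μ)

module Submission where

-- Call a triple of words s₁, s₂ ⊢ t a *lower-bound inference*
-- when every common lower bound of s₁ and s₂ (in the subword order ≼) lies
-- below t.  For a closed upper set Z we have Z ⊇ (Z^∇)^Δ, and every x ∈ Z^∇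
-- is a common lower bound of any two members of Z; hence Z is closed under
-- every lower-bound inference (`closed-under-inference`).  Inferences are
-- stable under prepending a common prefix y (`inference-prefix`), so each of
-- the four rules reduces to a purely local inference about the first one or
-- two letters after y:
--   cancellation  α z , β z ⊢ z       (α, β incompatible)
--   reduction     α α z , γ z ⊢ α z
--   permutation   α β z , γ z ⊢ β α z
--   meet          α z , β z ⊢ (α ∧ β) z
-- each proved by a short case analysis on how a lower bound embeds.  The
-- reduction and permutation inferences hold without their order-theoretic
-- side conditions.

open import Defs
open import Level using (Level; _⊔_)
open import Data.List using ([]; _∷_; _++_)
open import Data.Product using (_×_; _,_)
open import Relation.Binary.Bundles using (Poset)

module LowerBoundInference {c ℓ₁ ℓ₂ : Level} (Λ : Poset c ℓ₁ ℓ₂) where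
  open Words Λ

  Inference : Word → Word → Word → Set (c ⊔ ℓ₂)
  Inference s₁ s₂ t = ∀ x → x ≼ s₁ → x ≼ s₂ → x ≼ t

  ≼-tail : ∀ {u x w} → (u ∷ x) ≼ w → x ≼ w
  ≼-tail (take _ x≼w) = skip x≼w
  ≼-tail (skip ux≼w)  = skip (≼-tail ux≼w)

  ≼-insert-second : ∀ {x β α z} → x ≼ (β ∷ z) → x ≼ (β ∷ α ∷ z)
  ≼-insert-second []≼          = []≼
  ≼-insert-second (take u≤β e) = take u≤β (skip e)
  ≼-insert-second (skip e)     = skip (skip e)

  -- Inferences are stable under a common prefix: a lower bound of y s₁ and
  -- y s₂ either matches a letter of y in one of them or embeds into s₁, s₂.
  inference-prefix : ∀ {s₁ s₂ t} → Inference s₁ s₂ t →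
                     ∀ y → Inference (y ++ s₁) (y ++ s₂) (y ++ t)
  inference-prefix H []      x       e₁         e₂         = H x e₁ e₂
  inference-prefix H (_ ∷ y) []      _          _          = []≼
  inference-prefix H (_ ∷ y) (u ∷ x) (take p e₁) (take _ e₂) =
    take p (inference-prefix H y x e₁ e₂)
  inference-prefix H (_ ∷ y) (u ∷ x) (take p e₁) (skip e₂) =
    take p (inference-prefix H y x e₁ (≼-tail e₂))
  inference-prefix H (_ ∷ y) (u ∷ x) (skip e₁)  (take q e₂) =
    take q (inference-prefix H y x (≼-tail e₁) e₂)
  inference-prefix H (_ ∷ y) (u ∷ x) (skip e₁)  (skip e₂) =
    skip (inference-prefix H y (u ∷ x) e₁ e₂)

  -- A closed set is closed under every lower-bound inference, since t lies
  -- above every element of Z^∇ and hence in (Z^∇)^Δ ⊆ Z.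
  closed-under-inference : ∀ {ℓ} (Z : Subset ℓ) → IsClosed Z →
                           ∀ {s₁ s₂ t} → Inference s₁ s₂ t →
                           Z s₁ → Z s₂ → Z t
  closed-under-inference Z (_ , _ , Δ∇⊆Z) {s₁} {s₂} {t} H Zs₁ Zs₂ =
    Δ∇⊆Z t (λ x x∈Z∇ → H x (x∈Z∇ s₁ Zs₁) (x∈Z∇ s₂ Zs₂))

  -- Cancellation: a lower bound cannot use both α and β as its first
  -- letter, since that letter would be a common lower bound of α and β.
  cancellation : ∀ {α β} z → Incompatible α β → Inference (α ∷ z) (β ∷ z) z
  cancellation z inc []      _            _            = []≼
  cancellation z inc (u ∷ x) (skip e₁)    _            = e₁
  cancellation z inc (u ∷ x) (take _ _)   (skip e₂)    = e₂
  cancellation z inc (u ∷ x) (take u≤α _) (take u≤β _) with inc (u , u≤α , u≤β)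
  ... | ()

  reduction : ∀ {α γ} z → Inference (α ∷ α ∷ z) (γ ∷ z) (α ∷ z)
  reduction z []      _            _          = []≼
  reduction z (u ∷ x) _            (skip e₂)   = skip e₂
  reduction z (u ∷ x) (take u≤α _) (take _ e₂) = take u≤α e₂
  reduction z (u ∷ x) (skip e₁)    (take _ _)  = e₁

  permutation : ∀ {α β γ} z → Inference (α ∷ β ∷ z) (γ ∷ z) (β ∷ α ∷ z)
  permutation z []      _            _          = []≼
  permutation z (u ∷ x) _            (skip e₂)   = skip (skip e₂)
  permutation z (u ∷ x) (take u≤α _) (take _ e₂) = skip (take u≤α e₂)
  permutation z (u ∷ x) (skip e₁)    (take _ _)  = ≼-insert-second e₁

  -- Meet: a first letter below both α and β is below their meet μ.
  meet : ∀ {α β μ} z → IsMeet α β μ → Inference (α ∷ z) (β ∷ z) (μ ∷ z)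
  meet z _                []      _            _            = []≼
  meet z _                (u ∷ x) (skip e₁)    _            = skip e₁
  meet z _                (u ∷ x) (take _ _)   (skip e₂)    = skip e₂
  meet z (_ , _ , glb)    (u ∷ x) (take u≤α e₁) (take u≤β _) = take (glb u u≤α u≤β) e₁

  closed-under-rule : ∀ {ℓ} (Z : Subset ℓ) → IsClosed Z →
                      ∀ {s₁ s₂ t} → Inference s₁ s₂ t →
                      ∀ y → Z (y ++ s₁) → Z (y ++ s₂) → Z (y ++ t)
  closed-under-rule Z closed H y =
    closed-under-inference Z closed (inference-prefix H y)

lemma4p1 : ∀ {c ℓ₁ ℓ₂ ℓ : Level} (Λ : Poset c ℓ₁ ℓ₂) →
    let open Words Λ in
    (Z : Subset ℓ) → IsClosed Z →
      ((∀ (y z : Word) (α β : L) →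
          Z (y ++ α ∷ z) → Z (y ++ β ∷ z) → Incompatible α β → Z (y ++ z))
      × (∀ (y z : Word) (α γ : L) →
          Z (y ++ α ∷ α ∷ z) → Z (y ++ γ ∷ z) → α < γ → Z (y ++ α ∷ z))
      × (∀ (y z : Word) (α β γ : L) →
          Z (y ++ α ∷ β ∷ z) → Z (y ++ γ ∷ z) → Incomparable α β →
          α ≤ γ → β ≤ γ → Z (y ++ β ∷ α ∷ z))
      × (∀ (y z : Word) (α β μ : L) →
          Z (y ++ α ∷ z) → Z (y ++ β ∷ z) → Incomparable α β →
          IsMeet α β μ → Z (y ++ μ ∷ z)))
lemma4p1 Λ Z closed =
    (λ y z α β Z₁ Z₂ inc → rule (cancellation z inc) y Z₁ Z₂)
  , (λ y z α γ Z₁ Z₂ _ → rule (reduction z) y Z₁ Z₂)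
  , (λ y z α β γ Z₁ Z₂ _ _ _ → rule (permutation z) y Z₁ Z₂)
  , (λ y z α β μ Z₁ Z₂ _ isMeet → rule (meet z isMeet) y Z₁ Z₂)
  where
    open Words Λ
    open LowerBoundInference Λ
    rule : ∀ {s₁ s₂ t} → Inference s₁ s₂ t →
           ∀ y → Z (y ++ s₁) → Z (y ++ s₂) → Z (y ++ t)
    rule = closed-under-rule Z closed
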